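{- Let $q$ be a prime power, $t$ a positive integer, $n=2t$, $\xi\in\mathbb{F}_{q^n}\setminus\mathbb{F}_{q^t}$, and $L=L_{S_{x^q,\xi}\times S_{\mathrm{Tr}_{q^t/q},\xi}}$. Then for $\alpha\in\mathbb{F}_{q^n}$, the weight $w_L(\langle(1,\alpha)\rangle_{\mathbb{F}_{q^n}})$ is at most $1$ if $\alpha\in\mathbb{F}_{q^t}^*$, and at most $2$ if $\alpha\in\mathbb{F}_{q^n}^*$.
   Context: $\mathrm{Tr}_{q^t/q}(x)=\sum_{i=0}^{t-1}x^{q^i}$. For an $\mathbb{F}_q$-linear map $h$ of $\mathbb{F}_{q^t}$ and $\zeta\in\mathbb{F}_{q^{2t}}\setminus\mathbb{F}_{q^t}$, $S_{h,\zeta}=\{u+\zeta h(u): u\in\mathbb{F}_{q^t}\}$; $S_{x^q,\zeta}$ denotes this with $h(x)=x^q$. For an $\mathbb{F}_q$-subspace $U$ of $\mathbb{F}_{q^n}^2$, $L_U=\{\langle u\rangle_{\mathbb{F}_{q^n}}: u\in U\setminus\{0\}\}\subseteq\mathrm{PG}(1,q^n)$ and the weight of a point $\langle v\rangle_{\mathbb{F}_{q^n}}$ is $\dim_{\mathbb{F}_q}(U\cap\langle v\rangle_{\mathbb{F}_{q^n}})$. $S\times T=\{(s,t):s\in S,t\in T\}$. -}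

module Defs where

open import Level using (Level; _⊔_)
open import Data.Nat as ℕ using (ℕ; zero; suc)
open import Data.Fin using (Fin; zero; suc; toℕ)
open import Data.Vec using (Vec; lookup)
open import Data.Product using (Σ; ∃; _×_; _,_)
open import Relation.Nullary using (¬_)
open import Relation.Binary.PropositionalEquality using (_≡_)
open import Algebra.Bundles using (CommutativeRing)

module _ {c ℓ : Level} (R : CommutativeRing c ℓ) where
  open CommutativeRing R using (Carrier; _≈_; _+_; _*_; 0#; 1#)

  pow : Carrier → ℕ → Carrier
  pow x zero    = 1#
  pow x (suc n) = x * pow x n

  IsField : Set (c ⊔ ℓ)
  IsField = (¬ (1# ≈ 0#)) × (∀ x → ¬ (x ≈ 0#) → ∃ λ y → x * y ≈ 1#)

  HasCard : ℕ → Set (c ⊔ ℓ)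
  HasCard m = Σ (Vec Carrier m) λ v →
      (∀ x → ∃ λ i → x ≈ lookup v i)
    × (∀ i j → lookup v i ≈ lookup v j → i ≡ j)

  -- x lies in the subfield fixed by x ↦ x^Q (i.e. F_Q inside F_{q^n} when Q = q^m)
  InSub : ℕ → Carrier → Set ℓ
  InSub Q x = pow x Q ≈ x

  sumFin : (n : ℕ) → (Fin n → Carrier) → Carrier
  sumFin zero    f = 0#
  sumFin (suc n) f = f zero + sumFin n (λ i → f (suc i))

  Tr : (q t : ℕ) → Carrier → Carrier
  Tr q t x = sumFin t (λ i → pow x (q ℕ.^ toℕ i))

  InS : (q t : ℕ) → (Carrier → Carrier) → Carrier → Carrier → Set (c ⊔ ℓ)
  InS q t h ζ y = ∃ λ u → InSub (q ℕ.^ t) u × (y ≈ u + ζ * h u)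

  InSpan : Carrier × Carrier → Carrier × Carrier → Set (c ⊔ ℓ)
  InSpan (v₁ , v₂) (w₁ , w₂) = ∃ λ λ′ → (w₁ ≈ λ′ * v₁) × (w₂ ≈ λ′ * v₂)

  DimAtMost : ℕ → (Carrier × Carrier → Set (c ⊔ ℓ)) → ℕ → Set (c ⊔ ℓ)
  DimAtMost Q P k =
    (f₁ f₂ : Fin (suc k) → Carrier) → (∀ i → P (f₁ i , f₂ i)) →
    ∃ λ (γ : Fin (suc k) → Carrier) →
        (∀ i → InSub Q (γ i))
      × (∃ λ i → ¬ (γ i ≈ 0#))
      × (sumFin (suc k) (λ i → γ i * f₁ i) ≈ 0#)
      × (sumFin (suc k) (λ i → γ i * f₂ i) ≈ 0#)

  -- weight of the point ⟨v⟩ w.r.t. the F_q-subspace U is at most k: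
  -- dim_{F_q}(U ∩ ⟨v⟩_{F_{q^n}}) ≤ k
  WeightAtMost : ℕ → (Carrier × Carrier → Set (c ⊔ ℓ)) → Carrier × Carrier → ℕ → Set (c ⊔ ℓ)
  WeightAtMost Q U v k = DimAtMost Q (λ w → U w × InSpan v w) k

  InU : (q t : ℕ) → Carrier → Carrier × Carrier → Set (c ⊔ ℓ)
  InU q t ξ (a , b) = InS q t (λ x → pow x q) ξ a × InS q t (Tr q t) ξ b

{-# OPTIONS --safe #-}
-- A point (a, b) of U on the line ⟨(1, α)⟩ has b = aα, so the weight is the F_q-dimension of the
-- space A of those a ∈ S_{x^q,ξ} with aα ∈ S_{Tr,ξ}. Writing aα = v + ξ Tr(v) in the basis {1, ξ}
-- of F_{q^n} over F_{q^t}, the coordinate T = Tr(v) ∈ F_q is an F_q-linear functional on A, so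
-- dim A ≤ 1 + dim (kernel). On the kernel aα ∈ F_{q^t}, so two kernel elements differ by a factor
-- s ∈ F_{q^t}; comparing the coordinates of s(u + ξu^q) = u′ + ξu′^q gives s^q = s, hence the kernel
-- has dimension at most 1. If α ∈ F_{q^t}, the ξ-coordinate of (u + ξu^q)α is αu^q, which vanishes
-- only when a = 0, so the kernel is trivial. Throughout, x ↦ x^q is additive because a field with
-- p^M elements has characteristic p.
module Submission where

open import Defs
open import Level using (Level; _⊔_)
open import Data.Nat as ℕ using (ℕ; zero; suc)
import Data.Nat.Properties as ℕₚ
open import Data.Nat.Primality using (Prime)
open import Data.Fin using (Fin; zero; suc; toℕ; fromℕ; inject₁)
open import Data.Product using (∃; _×_; _,_; proj₁; proj₂)
open import Data.Sum using (inj₁; inj₂)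
open import Data.Vec using (lookup)
open import Data.Vec.Functional using (_∷_; [])
open import Relation.Nullary using (¬_; yes; no; contradiction)
open import Relation.Binary.Definitions using (Decidable)
open import Relation.Binary.PropositionalEquality as ≡ using (_≡_)
open import Algebra.Bundles using (CommutativeRing)

module _ where
  open import Data.Nat
  open import Data.Nat.Properties using (*-comm; *-zeroʳ; *-identityʳ; +-identityʳ; <⇒≱)
  open import Data.Nat.Combinatorics using (_C_; nC1≡n; nCk+nC[k+1]≡[n+1]C[k+1])
  open import Data.Nat.Divisibility using (_∣_; divides; ∣⇒≤)
  open import Data.Nat.Primality using (euclidsLemma)
  open import Data.Nat.Solver using (module +-*-Solver)
  open +-*-Solver
  open ≡.≡-Reasoning

  [1+k]*[1+n]C[1+k]≡[1+n]*nCk : ∀ n k → suc k * (suc n C suc k) ≡ suc n * (n C k)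
  [1+k]*[1+n]C[1+k]≡[1+n]*nCk zero    zero    = ≡.refl
  [1+k]*[1+n]C[1+k]≡[1+n]*nCk zero    (suc k) = *-zeroʳ (suc (suc k))
  [1+k]*[1+n]C[1+k]≡[1+n]*nCk (suc n) zero    =
    ≡.trans (+-identityʳ _) (≡.trans (nC1≡n (suc (suc n))) (≡.sym (*-identityʳ _)))
  [1+k]*[1+n]C[1+k]≡[1+n]*nCk (suc n) (suc k) = begin
      suc (suc k) * (suc (suc n) C suc (suc k))
    ≡⟨ ≡.cong (suc (suc k) *_) (nCk+nC[k+1]≡[n+1]C[k+1] (suc n) (suc k)) ⟨
      suc (suc k) * (A + B)
    ≡⟨ solve 3 (λ k A B → (con 2 :+ k) :* (A :+ B) := A :+ (con 1 :+ k) :* A :+ (con 2 :+ k) :* B)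
         ≡.refl k A B ⟩
      A + suc k * A + suc (suc k) * B
    ≡⟨ ≡.cong₂ (λ X Y → A + X + Y) ([1+k]*[1+n]C[1+k]≡[1+n]*nCk n k)
                                  ([1+k]*[1+n]C[1+k]≡[1+n]*nCk n (suc k)) ⟩
      A + suc n * (n C k) + suc n * (n C suc k)
    ≡⟨ solve 4 (λ A n X Y → A :+ (con 1 :+ n) :* X :+ (con 1 :+ n) :* Y := A :+ (con 1 :+ n) :* (X :+ Y))
         ≡.refl A n (n C k) (n C suc k) ⟩
      A + suc n * (n C k + n C suc k)
    ≡⟨ ≡.cong (λ X → A + suc n * X) (nCk+nC[k+1]≡[n+1]C[k+1] n k) ⟩
      A + suc n * A
    ∎
    where
    A = suc n C suc k
    B = suc n C suc (suc k)

  p∣pCk : ∀ {p k} → Prime p → 0 < k → k < p → p ∣ p C k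
  p∣pCk {suc n} {suc k} p-prime _ k<p
    with euclidsLemma (suc k) (suc n C suc k) p-prime
           (divides (n C k) (≡.trans ([1+k]*[1+n]C[1+k]≡[1+n]*nCk n k) (*-comm (suc n) (n C k))))
  ... | inj₁ p∣k = contradiction (∣⇒≤ p∣k) (<⇒≱ k<p)
  ... | inj₂ p∣C = p∣C

module _ {c ℓ : Level} (R : CommutativeRing c ℓ) where
  open CommutativeRing R hiding (zero)
  open import Algebra.Properties.CommutativeSemiring.Exp commutativeSemiring
    using (_^_; ^-congˡ; ^-assocʳ; ^-distrib-*)
  open import Algebra.Properties.CommutativeSemiring.Binomial commutativeSemiring
    using (theorem; binomialTerm)
  open import Algebra.Properties.CommutativeMonoid.Sum +-commutativeMonoid
    using (sum; sum-cong-≋; sum-permute; ∑-distrib-+; sum-replicate; sum-replicate-zero; sum-init-last)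
  open import Algebra.Properties.Semiring.Sum semiring using (*-distribʳ-sum)
  open import Algebra.Properties.Monoid.Mult +-monoid using (×-congʳ) renaming (_×_ to _×ₙ_)
  open import Algebra.Properties.Semiring.Mult semiring using (×1-homo-*; ×-assoc-*)
  open import Algebra.Properties.Group +-group
    using (identityˡ-unique; identityʳ-unique; inverseʳ-unique; x∙y⁻¹≈ε⇒x≈y)
  open import Algebra.Properties.AbelianGroup +-abelianGroup using (⁻¹-∙-comm)
  open import Algebra.Properties.Ring ring using (-‿distribˡ-*; -‿distribʳ-*; +-cancelˡ; +-cancelʳ)
  open import Algebra.Solver.Ring.NaturalCoefficients.Default commutativeSemiring
  open import Data.Nat.Combinatorics using (_C_; nCn≡1)
  open import Data.Nat.Divisibility using (_∣_; divides)
  open import Data.Fin.Properties using (toℕ-fromℕ; toℕ-inject₁; inject₁ℕ<)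
  open import Data.Fin.Permutation using (Permutation′; permutation)
  open import Relation.Binary.Reasoning.Setoid setoid

  pow≡^ : ∀ x n → pow R x n ≡ x ^ n
  pow≡^ x zero    = ≡.refl
  pow≡^ x (suc n) = ≡.cong (x *_) (pow≡^ x n)

  pow-cong : ∀ n {x y} → x ≈ y → pow R x n ≈ pow R y n
  pow-cong n {x} {y} x≈y rewrite pow≡^ x n | pow≡^ y n = ^-congˡ n x≈y

  pow-distrib-* : ∀ x y n → pow R (x * y) n ≈ pow R x n * pow R y n
  pow-distrib-* x y n rewrite pow≡^ (x * y) n | pow≡^ x n | pow≡^ y n = ^-distrib-* x y n

  pow-pow : ∀ x m n → pow R (pow R x m) n ≈ pow R x (m ℕ.* n)
  pow-pow x m n rewrite pow≡^ (pow R x m) n | pow≡^ x m | pow≡^ x (m ℕ.* n) = ^-assocʳ x m n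

  pow-1# : ∀ n → pow R 1# n ≈ 1#
  pow-1# zero    = refl
  pow-1# (suc n) = trans (*-identityˡ _) (pow-1# n)

  sumFin≡sum : ∀ n f → sumFin R n f ≡ sum f
  sumFin≡sum zero    f = ≡.refl
  sumFin≡sum (suc n) f = ≡.cong (f zero +_) (sumFin≡sum n (λ i → f (suc i)))

  sumFin-cong : ∀ n {f g} → (∀ i → f i ≈ g i) → sumFin R n f ≈ sumFin R n g
  sumFin-cong n {f} {g} f≈g rewrite sumFin≡sum n f | sumFin≡sum n g = sum-cong-≋ f≈g

  sumFin-*-distribʳ : ∀ n f x → sumFin R n f * x ≈ sumFin R n (λ i → f i * x)
  sumFin-*-distribʳ n f x rewrite sumFin≡sum n f | sumFin≡sum n (λ i → f i * x) = *-distribʳ-sum x f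

  sumFin-zero : ∀ n → sumFin R n (λ _ → 0#) ≈ 0#
  sumFin-zero n rewrite sumFin≡sum n (λ _ → 0#) = sum-replicate-zero n

  sumFin-init-last : ∀ n f → sumFin R (suc n) f ≈ sumFin R n (λ i → f (inject₁ i)) + f (fromℕ n)
  sumFin-init-last n f rewrite sumFin≡sum (suc n) f | sumFin≡sum n (λ i → f (inject₁ i)) =
    sum-init-last f

  -- The Frobenius map

  record PowAdditive (n : ℕ) : Set (c ⊔ ℓ) where
    field
      pow-+ : ∀ x y → pow R (x + y) n ≈ pow R x n + pow R y n

  open PowAdditive public

  powAdditive-* : ∀ {m n} → PowAdditive m → PowAdditive n → PowAdditive (m ℕ.* n)
  pow-+ (powAdditive-* {m} {n} additive-m additive-n) x y = begin
    pow R (x + y) (m ℕ.* n)                    ≈⟨ pow-pow (x + y) m n ⟨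
    pow R (pow R (x + y) m) n                  ≈⟨ pow-cong n (pow-+ additive-m x y) ⟩
    pow R (pow R x m + pow R y m) n            ≈⟨ pow-+ additive-n _ _ ⟩
    pow R (pow R x m) n + pow R (pow R y m) n  ≈⟨ +-cong (pow-pow x m n) (pow-pow y m n) ⟩
    pow R x (m ℕ.* n) + pow R y (m ℕ.* n)      ∎

  powAdditive-^ : ∀ {m} → PowAdditive m → ∀ n → PowAdditive (m ℕ.^ n)
  pow-+ (powAdditive-^ additive zero) x y =
    trans (*-identityʳ (x + y)) (sym (+-cong (*-identityʳ x) (*-identityʳ y)))
  powAdditive-^ {m} additive (suc n) = powAdditive-* {m} {m ℕ.^ n} additive (powAdditive-^ additive n)

  ∣⇒×≈0# : ∀ {p m} → p ×ₙ 1# ≈ 0# → p ∣ m → ∀ x → m ×ₙ x ≈ 0#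
  ∣⇒×≈0# {p} p×1≈0 (divides d ≡.refl) x = begin
    (d ℕ.* p) ×ₙ x               ≈⟨ ×-congʳ (d ℕ.* p) (*-identityˡ x) ⟨
    (d ℕ.* p) ×ₙ (1# * x)        ≈⟨ ×-assoc-* (d ℕ.* p) 1# x ⟨
    ((d ℕ.* p) ×ₙ 1#) * x        ≈⟨ *-congʳ (×1-homo-* d p) ⟩
    ((d ×ₙ 1#) * (p ×ₙ 1#)) * x  ≈⟨ *-congʳ (*-congˡ p×1≈0) ⟩
    ((d ×ₙ 1#) * 0#) * x         ≈⟨ *-congʳ (zeroʳ _) ⟩
    0# * x                       ≈⟨ zeroˡ x ⟩
    0#                           ∎

  frobenius : ∀ {p} → Prime p → p ×ₙ 1# ≈ 0# → PowAdditive p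
  pow-+ (frobenius {suc n} p-prime p×1≈0) x y = begin
    pow R (x + y) p
      ≡⟨ pow≡^ (x + y) p ⟩
    (x + y) ^ p
      ≈⟨ theorem p x y ⟩
    term zero + sum (λ i → term (suc i))
      ≈⟨ +-congˡ (sum-init-last (λ i → term (suc i))) ⟩
    term zero + (sum (λ j → term (suc (inject₁ j))) + term (fromℕ p))
      ≈⟨ +-cong first (+-cong middle (last (toℕ-fromℕ p))) ⟩
    y ^ p + (0# + x ^ p)
      ≈⟨ trans (+-congˡ (+-identityˡ _)) (+-comm _ _) ⟩
    x ^ p + y ^ p
      ≡⟨ ≡.cong₂ _+_ (pow≡^ x p) (pow≡^ y p) ⟨
    pow R x p + pow R y p
      ∎
    where
    p = suc n
    term = binomialTerm x y p
    first : term zero ≈ y ^ p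
    first = trans (+-identityʳ _) (*-identityˡ _)
    middle : sum (λ j → term (suc (inject₁ j))) ≈ 0#
    middle = trans
      (sum-cong-≋ λ j → ∣⇒×≈0# p×1≈0 (p∣pCk p-prime (ℕ.s≤s ℕ.z≤n) (ℕ.s≤s (inject₁ℕ< j))) _)
      (sum-replicate-zero n)
    last : ∀ {k} → k ≡ p → (p C k) ×ₙ (x ^ k * y ^ (p ℕ.∸ k)) ≈ x ^ p
    last ≡.refl rewrite nCn≡1 p | ℕₚ.n∸n≡0 p = trans (+-identityʳ _) (*-identityʳ _)

  module _ {N : ℕ} (card : HasCard R N) where
    private
      element : Fin N → Carrier
      element = lookup (proj₁ card)

      index : Carrier → Fin N
      index x = proj₁ (proj₁ (proj₂ card) x)

      ≈element-index : ∀ x → x ≈ element (index x)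
      ≈element-index x = proj₂ (proj₁ (proj₂ card) x)

      index-unique : ∀ {x j} → x ≈ element j → index x ≡ j
      index-unique {x} {j} x≈j = proj₂ (proj₂ card) (index x) j (trans (sym (≈element-index x)) x≈j)

      translation : Carrier → Permutation′ N
      translation x = permutation (λ i → index (x + element i)) (λ j → index (- x + element j))
        (λ j → index-unique (begin
          x + element (index (- x + element j))  ≈⟨ +-congˡ (≈element-index _) ⟨
          x + (- x + element j)                  ≈⟨ +-assoc _ _ _ ⟨
          (x + - x) + element j                  ≈⟨ +-congʳ (-‿inverseʳ x) ⟩
          0# + element j                         ≈⟨ +-identityˡ _ ⟩
          element j                              ∎))
        (λ i → index-unique (begin
          - x + element (index (x + element i))  ≈⟨ +-congˡ (≈element-index _) ⟨
          - x + (x + element i)                  ≈⟨ +-assoc _ _ _ ⟨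
          (- x + x) + element i                  ≈⟨ +-congʳ (-‿inverseˡ x) ⟩
          0# + element i                         ≈⟨ +-identityˡ _ ⟩
          element i                              ∎))

    ≈-decidable : Decidable _≈_
    ≈-decidable x y with index x Data.Fin.≟ index y
    ... | yes i≡j = yes (trans (≈element-index x)
                               (trans (reflexive (≡.cong element i≡j)) (sym (≈element-index y))))
    ... | no i≢j  = no λ x≈y → i≢j (index-unique (trans x≈y (≈element-index y)))

    -- Adding x permutes the elements, so N × x + Σ elements = Σ elements.
    card×≈0# : ∀ x → N ×ₙ x ≈ 0#
    card×≈0# x = identityˡ-unique (N ×ₙ x) (sum element) (begin
      N ×ₙ x + sum element                         ≈⟨ +-congʳ (sum-replicate N {x}) ⟨
      sum {N} (λ _ → x) + sum element              ≈⟨ ∑-distrib-+ (λ _ → x) element ⟨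
      sum (λ i → x + element i)                    ≈⟨ sum-cong-≋ {N} (λ i → ≈element-index (x + element i)) ⟩
      sum (λ i → element (index (x + element i)))  ≈⟨ sum-permute element (translation x) ⟨
      sum element                                  ∎)

  ×1-homo-^ : ∀ p M → (p ℕ.^ M) ×ₙ 1# ≈ pow R (p ×ₙ 1#) M
  ×1-homo-^ p zero    = +-identityʳ 1#
  ×1-homo-^ p (suc M) = trans (×1-homo-* p (p ℕ.^ M)) (*-congˡ (×1-homo-^ p M))

  -- Fixed points of x ↦ x^Q

  InSub-resp-≈ : ∀ {Q x y} → x ≈ y → InSub R Q x → InSub R Q y
  InSub-resp-≈ {Q} x≈y xᵠ≈x = trans (pow-cong Q (sym x≈y)) (trans xᵠ≈x x≈y)

  InSub-1# : ∀ {Q} → InSub R Q 1#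
  InSub-1# {Q} = pow-1# Q

  InSub-* : ∀ {Q x y} → InSub R Q x → InSub R Q y → InSub R Q (x * y)
  InSub-* {Q} {x} {y} x∈ y∈ = trans (pow-distrib-* x y Q) (*-cong x∈ y∈)

  InSub-pow : ∀ {Q x} n → InSub R Q x → InSub R Q (pow R x n)
  InSub-pow {Q} {x} n xᵠ≈x = begin
    pow R (pow R x n) Q  ≈⟨ pow-pow x n Q ⟩
    pow R x (n ℕ.* Q)    ≡⟨ ≡.cong (pow R x) (ℕₚ.*-comm n Q) ⟩
    pow R x (Q ℕ.* n)    ≈⟨ pow-pow x Q n ⟨
    pow R (pow R x Q) n  ≈⟨ pow-cong n xᵠ≈x ⟩
    pow R x n            ∎

  InSub-^ : ∀ {q x} t → InSub R q x → InSub R (q ℕ.^ t) x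
  InSub-^ zero    x∈ = *-identityʳ _
  InSub-^ {q} {x} (suc t) x∈ =
    trans (sym (pow-pow x q (q ℕ.^ t))) (trans (pow-cong (q ℕ.^ t) x∈) (InSub-^ t x∈))

  module _ {Q : ℕ} (additive : PowAdditive Q) where

    pow-0# : pow R 0# Q ≈ 0#
    pow-0# = identityʳ-unique (pow R 0# Q) (pow R 0# Q)
      (trans (sym (pow-+ additive 0# 0#)) (pow-cong Q (+-identityʳ 0#)))

    pow-neg : ∀ x → pow R (- x) Q ≈ - pow R x Q
    pow-neg x = inverseʳ-unique (pow R x Q) (pow R (- x) Q)
      (trans (sym (pow-+ additive x (- x))) (trans (pow-cong Q (-‿inverseʳ x)) pow-0#))

    pow-sumFin : ∀ n f → pow R (sumFin R n f) Q ≈ sumFin R n (λ i → pow R (f i) Q)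
    pow-sumFin zero    f = pow-0#
    pow-sumFin (suc n) f = trans (pow-+ additive _ _) (+-congˡ (pow-sumFin n (λ i → f (suc i))))

    pow-linear : ∀ {k k′} → InSub R Q k → InSub R Q k′ → ∀ x y →
      pow R (k * x + k′ * y) Q ≈ k * pow R x Q + k′ * pow R y Q
    pow-linear {k} {k′} k∈ k′∈ x y = trans (pow-+ additive (k * x) (k′ * y))
      (+-cong (trans (pow-distrib-* k x Q) (*-congʳ k∈)) (trans (pow-distrib-* k′ y Q) (*-congʳ k′∈)))

    InSub-0# : InSub R Q 0#
    InSub-0# = pow-0#

    InSub-+ : ∀ {x y} → InSub R Q x → InSub R Q y → InSub R Q (x + y)
    InSub-+ {x} {y} x∈ y∈ = trans (pow-+ additive x y) (+-cong x∈ y∈)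

    InSub-neg : ∀ {x} → InSub R Q x → InSub R Q (- x)
    InSub-neg {x} x∈ = trans (pow-neg x) (-‿cong x∈)

    -- Tr(v) + v = v + Tr(v)^Q: both are Σ_{j ≤ t} v^{Q^j}, using v^{Q^t} = v.
    Tr-InSub : ∀ t {v} → InSub R (Q ℕ.^ t) v → InSub R Q (Tr R Q t v)
    Tr-InSub t {v} v∈ = +-cancelˡ v _ _ (begin
      v + pow R (Tr R Q t v) Q
        ≈⟨ +-congˡ (pow-sumFin t _) ⟩
      v + sumFin R t (λ i → pow R (pow R v (Q ℕ.^ toℕ i)) Q)
        ≈⟨ +-cong (sym (*-identityʳ v)) (sumFin-cong t λ i → trans (pow-pow v (Q ℕ.^ toℕ i) Q)
                                          (reflexive (≡.cong (pow R v) (ℕₚ.*-comm (Q ℕ.^ toℕ i) Q)))) ⟩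
      sumFin R (suc t) g
        ≈⟨ sumFin-init-last t g ⟩
      sumFin R t (λ i → g (inject₁ i)) + g (fromℕ t)
        ≈⟨ +-cong (sumFin-cong t λ i → reflexive (≡.cong (λ m → pow R v (Q ℕ.^ m)) (toℕ-inject₁ i)))
                  (trans (reflexive (≡.cong (λ m → pow R v (Q ℕ.^ m)) (toℕ-fromℕ t))) v∈) ⟩
      Tr R Q t v + v
        ≈⟨ +-comm _ _ ⟩
      v + Tr R Q t v
        ∎)
      where
      g : Fin (suc t) → Carrier
      g j = pow R v (Q ℕ.^ toℕ j)

  -- Linear dependence over the fixed field of x ↦ x^q

  Dependent : ℕ → (k : ℕ) → (Fin k → Carrier) → Set (c ⊔ ℓ)
  Dependent q k a = ∃ λ (γ : Fin k → Carrier) →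
    (∀ i → InSub R q (γ i)) × (∃ λ i → ¬ γ i ≈ 0#) × (sumFin R k (λ i → γ i * a i) ≈ 0#)

  InSpan-graph : ∀ {α a b} → InSpan R (1# , α) (a , b) → b ≈ a * α
  InSpan-graph {α} (λ′ , a≈λ′ , b≈λ′α) =
    trans b≈λ′α (*-congʳ (trans (sym (*-identityʳ λ′)) (sym a≈λ′)))

  dimAtMost-of-graph : ∀ {q} {P : Carrier × Carrier → Set (c ⊔ ℓ)} α k →
    (∀ {a b} → P (a , b) → b ≈ a * α) →
    (∀ f₁ f₂ → (∀ i → P (f₁ i , f₂ i)) → Dependent q (suc k) f₁) →
    DimAtMost R q P k
  dimAtMost-of-graph α k graph dependent f₁ f₂ P-f with dependent f₁ f₂ P-f
  ... | γ , γ∈ , nonzero , γf₁≈0 = γ , γ∈ , nonzero , γf₁≈0 , (begin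
    sumFin R (suc k) (λ i → γ i * f₂ i)
      ≈⟨ sumFin-cong (suc k) (λ i → trans (*-congˡ (graph (P-f i))) (sym (*-assoc (γ i) (f₁ i) α))) ⟩
    sumFin R (suc k) (λ i → γ i * f₁ i * α)  ≈⟨ sumFin-*-distribʳ (suc k) (λ i → γ i * f₁ i) α ⟨
    sumFin R (suc k) (λ i → γ i * f₁ i) * α  ≈⟨ *-congʳ γf₁≈0 ⟩
    0# * α                                   ≈⟨ zeroˡ α ⟩
    0#                                       ∎)

  module _ (isField : IsField R) where

    1≉0 : ¬ 1# ≈ 0#
    1≉0 = proj₁ isField

    *-cancelˡ : ∀ {x y z} → ¬ x ≈ 0# → x * y ≈ x * z → y ≈ z
    *-cancelˡ {x} {y} {z} x≉0 xy≈xz with proj₂ isField x x≉0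
    ... | w , xw≈1 = trans (sym (w*[x*y]≈y y)) (trans (*-congˡ xy≈xz) (w*[x*y]≈y z))
      where
      w*[x*y]≈y : ∀ y → w * (x * y) ≈ y
      w*[x*y]≈y y = trans (sym (*-assoc w x y)) (trans (*-congʳ (trans (*-comm w x) xw≈1)) (*-identityˡ y))

    *-≉0 : ∀ {x y} → ¬ x ≈ 0# → ¬ y ≈ 0# → ¬ x * y ≈ 0#
    *-≉0 {x} x≉0 y≉0 xy≈0 = y≉0 (*-cancelˡ x≉0 (trans xy≈0 (sym (zeroʳ x))))

    pow-≉0 : ∀ {x} n → ¬ x ≈ 0# → ¬ pow R x n ≈ 0#
    pow-≉0 zero    x≉0 = 1≉0
    pow-≉0 (suc n) x≉0 = *-≉0 x≉0 (pow-≉0 n x≉0)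

    pow≈0⇒≈0 : Decidable _≈_ → ∀ {x} n → pow R x n ≈ 0# → x ≈ 0#
    pow≈0⇒≈0 _≟_ {x} n xⁿ≈0 with x ≟ 0#
    ... | yes x≈0 = x≈0
    ... | no x≉0  = contradiction xⁿ≈0 (pow-≉0 n x≉0)

    card-p^M⇒p×1#≈0# : ∀ {p M} → HasCard R (p ℕ.^ M) → p ×ₙ 1# ≈ 0#
    card-p^M⇒p×1#≈0# {p} {M} card =
      pow≈0⇒≈0 (≈-decidable card) M (trans (sym (×1-homo-^ p M)) (card×≈0# card 1#))

    finite-frobenius : ∀ {p M} → Prime p → HasCard R (p ℕ.^ M) → PowAdditive p
    finite-frobenius {p} {M} p-prime card = frobenius p-prime (card-p^M⇒p×1#≈0# {p} {M} card)

    InSub-inverse : ∀ {Q x y} → InSub R Q x → x * y ≈ 1# → InSub R Q y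
    InSub-inverse {Q} {x} {y} x∈ xy≈1 = *-cancelˡ x≉0 (begin
      x * pow R y Q          ≈⟨ *-congʳ x∈ ⟨
      pow R x Q * pow R y Q  ≈⟨ pow-distrib-* x y Q ⟨
      pow R (x * y) Q        ≈⟨ pow-cong Q xy≈1 ⟩
      pow R 1# Q             ≈⟨ pow-1# Q ⟩
      1#                     ≈⟨ xy≈1 ⟨
      x * y                  ∎)
      where
      x≉0 : ¬ x ≈ 0#
      x≉0 x≈0 = 1≉0 (trans (sym xy≈1) (trans (*-congʳ x≈0) (zeroˡ y)))

    module _ (_≟_ : Decidable _≈_) {q : ℕ} (additive : PowAdditive q) where

      dependent-head≈0 : ∀ {k a} → a zero ≈ 0# → Dependent q (suc k) a
      dependent-head≈0 {k} {a} a₀≈0 = (1# ∷ λ _ → 0#) , coefficients , (zero , 1≉0) , (begin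
        1# * a zero + sumFin R k (λ i → 0# * a (suc i))
          ≈⟨ +-cong (trans (*-identityˡ _) a₀≈0) (sumFin-cong k λ i → zeroˡ _) ⟩
        0# + sumFin R k (λ _ → 0#)
          ≈⟨ trans (+-identityˡ _) (sumFin-zero k) ⟩
        0#
          ∎)
        where
        coefficients : ∀ i → InSub R q ((1# ∷ λ _ → 0#) i)
        coefficients zero    = InSub-1# {q}
        coefficients (suc i) = InSub-0# additive

      dependent₂⇒dependent₃ : ∀ {a₀ a₁ a₂} →
        Dependent q 2 (a₀ ∷ a₁ ∷ []) → Dependent q 3 (a₀ ∷ a₁ ∷ a₂ ∷ [])
      dependent₂⇒dependent₃ {a₀} {a₁} {a₂} (d , d∈ , (i , dᵢ≉0) , Σ≈0) =
        γ , coefficients , nonzero i dᵢ≉0 , (begin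
          d₀ * a₀ + (d₁ * a₁ + (0# * a₂ + 0#))  ≈⟨ +-congˡ (+-congˡ (trans (+-identityʳ _) (zeroˡ a₂))) ⟩
          d₀ * a₀ + (d₁ * a₁ + 0#)              ≈⟨ Σ≈0 ⟩
          0#                                    ∎)
        where
        d₀ = d zero
        d₁ = d (suc zero)
        γ : Fin 3 → Carrier
        γ = d₀ ∷ d₁ ∷ 0# ∷ []
        coefficients : ∀ j → InSub R q (γ j)
        coefficients zero             = d∈ zero
        coefficients (suc zero)       = d∈ (suc zero)
        coefficients (suc (suc zero)) = InSub-0# additive
        nonzero : ∀ j → ¬ d j ≈ 0# → ∃ λ k → ¬ γ k ≈ 0#
        nonzero zero       d₀≉0 = zero , d₀≉0
        nonzero (suc zero) d₁≉0 = suc zero , d₁≉0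

      dependent₃-pivot₀ : ∀ {a₀ a₁ a₂ T₀ T₁ T₂} →
        InSub R q T₀ → InSub R q T₁ → InSub R q T₂ → ¬ T₀ ≈ 0# →
        Dependent q 2 ((T₀ * a₁ + - T₁ * a₀) ∷ (T₀ * a₂ + - T₂ * a₀) ∷ []) →
        Dependent q 3 (a₀ ∷ a₁ ∷ a₂ ∷ [])
      dependent₃-pivot₀ {a₀} {a₁} {a₂} {T₀} {T₁} {T₂} T₀∈ T₁∈ T₂∈ T₀≉0 (d , d∈ , (i , dᵢ≉0) , Σ≈0) =
        γ , coefficients , (suc i , *-≉0 dᵢ≉0 T₀≉0) , (begin
          (d₀ * - T₁ + d₁ * - T₂) * a₀ + (d₀ * T₀ * a₁ + (d₁ * T₀ * a₂ + 0#))
            ≈⟨ solve 8 (λ d₀ d₁ T₀ T₁ T₂ a₀ a₁ a₂ →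
                 (d₀ :* T₁ :+ d₁ :* T₂) :* a₀ :+ (d₀ :* T₀ :* a₁ :+ (d₁ :* T₀ :* a₂ :+ con 0))
                   := d₀ :* (T₀ :* a₁ :+ T₁ :* a₀) :+ (d₁ :* (T₀ :* a₂ :+ T₂ :* a₀) :+ con 0))
                 refl d₀ d₁ T₀ (- T₁) (- T₂) a₀ a₁ a₂ ⟩
          d₀ * (T₀ * a₁ + - T₁ * a₀) + (d₁ * (T₀ * a₂ + - T₂ * a₀) + 0#)
            ≈⟨ Σ≈0 ⟩
          0#
            ∎)
        where
        d₀ = d zero
        d₁ = d (suc zero)
        γ : Fin 3 → Carrier
        γ = (d₀ * - T₁ + d₁ * - T₂) ∷ λ j → d j * T₀
        coefficients : ∀ j → InSub R q (γ j)
        coefficients zero    = InSub-+ additive (InSub-* {q} (d∈ zero) (InSub-neg additive T₁∈))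
                                                (InSub-* {q} (d∈ (suc zero)) (InSub-neg additive T₂∈))
        coefficients (suc j) = InSub-* {q} (d∈ j) T₀∈

      dependent₃-pivot₁ : ∀ {a₀ a₁ a₂ T₁ T₂} → InSub R q T₁ → InSub R q T₂ → ¬ T₁ ≈ 0# →
        Dependent q 2 (a₀ ∷ (T₁ * a₂ + - T₂ * a₁) ∷ []) →
        Dependent q 3 (a₀ ∷ a₁ ∷ a₂ ∷ [])
      dependent₃-pivot₁ {a₀} {a₁} {a₂} {T₁} {T₂} T₁∈ T₂∈ T₁≉0 (d , d∈ , (i , dᵢ≉0) , Σ≈0) =
        γ , coefficients , nonzero i dᵢ≉0 , (begin
          d₀ * a₀ + (d₁ * - T₂ * a₁ + (d₁ * T₁ * a₂ + 0#))
            ≈⟨ +-congˡ (solve 5 (λ d₁ T₁ T₂ a₁ a₂ →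
                 d₁ :* T₂ :* a₁ :+ (d₁ :* T₁ :* a₂ :+ con 0) := d₁ :* (T₁ :* a₂ :+ T₂ :* a₁) :+ con 0)
                 refl d₁ T₁ (- T₂) a₁ a₂) ⟩
          d₀ * a₀ + (d₁ * (T₁ * a₂ + - T₂ * a₁) + 0#)
            ≈⟨ Σ≈0 ⟩
          0#
            ∎)
        where
        d₀ = d zero
        d₁ = d (suc zero)
        γ : Fin 3 → Carrier
        γ = d₀ ∷ d₁ * - T₂ ∷ d₁ * T₁ ∷ []
        coefficients : ∀ j → InSub R q (γ j)
        coefficients zero             = d∈ zero
        coefficients (suc zero)       = InSub-* {q} (d∈ (suc zero)) (InSub-neg additive T₂∈)
        coefficients (suc (suc zero)) = InSub-* {q} (d∈ (suc zero)) T₁∈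
        nonzero : ∀ j → ¬ d j ≈ 0# → ∃ λ k → ¬ γ k ≈ 0#
        nonzero zero       d₀≉0 = zero , d₀≉0
        nonzero (suc zero) d₁≉0 = suc (suc zero) , *-≉0 d₁≉0 T₁≉0

      -- G a T says that a belongs to an F_q-space A and that T is the value at a of an
      -- F_q-linear functional on A; Gaussian elimination against that functional.
      module Dependence
        (G : Carrier → Carrier → Set (c ⊔ ℓ))
        (G-InSub : ∀ {a T} → G a T → InSub R q T)
        (G-lincomb : ∀ {k k′ a a′ T T′} → InSub R q k → InSub R q k′ → G a T → G a′ T′ →
                     G (k * a + k′ * a′) (k * T + k′ * T′))
        where

        Kernel : Carrier → Set (c ⊔ ℓ)
        Kernel a = ∃ λ T → G a T × T ≈ 0#

        eliminate : ∀ {a b T U} → G a T → G b U → Kernel (T * b + - U * a)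
        eliminate {T = T} {U} g h =
          T * U + - U * T , G-lincomb (G-InSub g) (InSub-neg additive (G-InSub h)) h g , (begin
            T * U + - U * T    ≈⟨ +-cong (*-comm T U) (sym (-‿distribˡ-* U T)) ⟩
            U * T + - (U * T)  ≈⟨ -‿inverseʳ (U * T) ⟩
            0#                 ∎)

        dependent₂ : (∀ {a} → Kernel a → a ≈ 0#) →
          ∀ {a₀ a₁ T₀ T₁} → G a₀ T₀ → G a₁ T₁ → Dependent q 2 (a₀ ∷ a₁ ∷ [])
        dependent₂ kernel-trivial {a₀} {a₁} {T₀} {T₁} g₀ g₁ with T₀ ≟ 0#
        ... | yes T₀≈0 = dependent-head≈0 {a = a₀ ∷ a₁ ∷ []} (kernel-trivial (T₀ , g₀ , T₀≈0))
        ... | no T₀≉0  = (- T₁ ∷ T₀ ∷ []) , coefficients , (suc zero , T₀≉0) , (begin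
          - T₁ * a₀ + (T₀ * a₁ + 0#)  ≈⟨ trans (+-congˡ (+-identityʳ _)) (+-comm _ _) ⟩
          T₀ * a₁ + - T₁ * a₀         ≈⟨ kernel-trivial (eliminate g₀ g₁) ⟩
          0#                          ∎)
          where
          coefficients : ∀ i → InSub R q ((- T₁ ∷ T₀ ∷ []) i)
          coefficients zero       = InSub-neg additive (G-InSub g₁)
          coefficients (suc zero) = G-InSub g₀

        dependent₃ : (∀ {a₀ a₁} → Kernel a₀ → Kernel a₁ → Dependent q 2 (a₀ ∷ a₁ ∷ [])) →
          ∀ {a₀ a₁ a₂ T₀ T₁ T₂} → G a₀ T₀ → G a₁ T₁ → G a₂ T₂ → Dependent q 3 (a₀ ∷ a₁ ∷ a₂ ∷ [])
        dependent₃ kernel-dependent {T₀ = T₀} {T₁} g₀ g₁ g₂ with T₀ ≟ 0# | T₁ ≟ 0#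
        ... | no T₀≉0  | _        = dependent₃-pivot₀ (G-InSub g₀) (G-InSub g₁) (G-InSub g₂) T₀≉0
                                      (kernel-dependent (eliminate g₀ g₁) (eliminate g₀ g₂))
        ... | yes T₀≈0 | no T₁≉0  = dependent₃-pivot₁ (G-InSub g₁) (G-InSub g₂) T₁≉0
                                      (kernel-dependent (T₀ , g₀ , T₀≈0) (eliminate g₁ g₂))
        ... | yes T₀≈0 | yes T₁≈0 = dependent₂⇒dependent₃
                                      (kernel-dependent (T₀ , g₀ , T₀≈0) (T₁ , g₁ , T₁≈0))

      -- Points of S_{x^q,ξ} × S_{Tr,ξ} on the line ⟨(1, α)⟩

      module Weight (t : ℕ) (ξ : Carrier) (ξ∉ : ¬ InSub R (q ℕ.^ t) ξ) (α : Carrier) where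

        Q : ℕ
        Q = q ℕ.^ t

        additiveQ : PowAdditive Q
        additiveQ = powAdditive-^ additive t

        ξ-independent : ∀ {z₀ z₁} → InSub R Q z₀ → InSub R Q z₁ → z₀ + ξ * z₁ ≈ 0# → z₁ ≈ 0#
        ξ-independent {z₀} {z₁} z₀∈ z₁∈ z≈0 with z₁ ≟ 0#
        ... | yes z₁≈0 = z₁≈0
        ... | no z₁≉0 with proj₂ isField z₁ z₁≉0
        ... | w , z₁w≈1 = contradiction
          (InSub-resp-≈ {Q} -z₀w≈ξ (InSub-* {Q} (InSub-neg additiveQ z₀∈) (InSub-inverse {Q} z₁∈ z₁w≈1))) ξ∉
          where
          -z₀w≈ξ : - z₀ * w ≈ ξ
          -z₀w≈ξ = begin
            - z₀ * w      ≈⟨ *-congʳ (inverseʳ-unique z₀ (ξ * z₁) z≈0) ⟨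
            ξ * z₁ * w    ≈⟨ *-assoc ξ z₁ w ⟩
            ξ * (z₁ * w)  ≈⟨ *-congˡ z₁w≈1 ⟩
            ξ * 1#        ≈⟨ *-identityʳ ξ ⟩
            ξ             ∎

        ξ-coordinates-unique : ∀ {x₀ x₁ y₀ y₁} →
          InSub R Q x₀ → InSub R Q x₁ → InSub R Q y₀ → InSub R Q y₁ →
          x₀ + ξ * x₁ ≈ y₀ + ξ * y₁ → x₀ ≈ y₀ × x₁ ≈ y₁
        ξ-coordinates-unique {x₀} {x₁} {y₀} {y₁} x₀∈ x₁∈ y₀∈ y₁∈ x≈y = x₀≈y₀ , x₁≈y₁
          where
          difference≈0 : (x₀ + - y₀) + ξ * (x₁ + - y₁) ≈ 0#
          difference≈0 = begin
            (x₀ + - y₀) + ξ * (x₁ + - y₁)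
              ≈⟨ solve 5 (λ x₀ x₁ y₀ y₁ ξ →
                   (x₀ :+ y₀) :+ ξ :* (x₁ :+ y₁) := (x₀ :+ ξ :* x₁) :+ (y₀ :+ ξ :* y₁))
                   refl x₀ x₁ (- y₀) (- y₁) ξ ⟩
            (x₀ + ξ * x₁) + (- y₀ + ξ * - y₁)
              ≈⟨ +-cong x≈y (trans (+-congˡ (sym (-‿distribʳ-* ξ y₁))) (⁻¹-∙-comm y₀ (ξ * y₁))) ⟩
            (y₀ + ξ * y₁) + - (y₀ + ξ * y₁)
              ≈⟨ -‿inverseʳ _ ⟩
            0#
              ∎
          x₁≈y₁ : x₁ ≈ y₁
          x₁≈y₁ = x∙y⁻¹≈ε⇒x≈y x₁ y₁ (ξ-independent (InSub-+ additiveQ x₀∈ (InSub-neg additiveQ y₀∈))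
                                                     (InSub-+ additiveQ x₁∈ (InSub-neg additiveQ y₁∈))
                                                     difference≈0)
          x₀≈y₀ : x₀ ≈ y₀
          x₀≈y₀ = +-cancelʳ (ξ * y₁) x₀ y₀ (trans (+-congˡ (*-congˡ (sym x₁≈y₁))) x≈y)

        InSxq : Carrier → Set (c ⊔ ℓ)
        InSxq = InS R q t (λ x → pow R x q) ξ

        u≈0⇒u+ξuᵠ≈0 : ∀ {u} → u ≈ 0# → u + ξ * pow R u q ≈ 0#
        u≈0⇒u+ξuᵠ≈0 {u} u≈0 = begin
          u + ξ * pow R u q  ≈⟨ +-cong u≈0 (*-congˡ (trans (pow-cong q u≈0) (pow-0# additive))) ⟩
          0# + ξ * 0#        ≈⟨ trans (+-identityˡ _) (zeroʳ ξ) ⟩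
          0#                 ∎

        InSxq-ratio : ∀ {a s} → InSxq a → ¬ a ≈ 0# → InSub R Q s → InSxq (s * a) → InSub R q s
        InSxq-ratio {a} {s} (u , u∈ , a≈) a≉0 s∈ (u′ , u′∈ , sa≈) = *-cancelˡ uᵠ≉0 (begin
          pow R u q * pow R s q  ≈⟨ *-comm _ _ ⟩
          pow R s q * pow R u q  ≈⟨ pow-distrib-* s u q ⟨
          pow R (s * u) q        ≈⟨ pow-cong q (proj₁ coordinates) ⟩
          pow R u′ q             ≈⟨ proj₂ coordinates ⟨
          s * pow R u q          ≈⟨ *-comm _ _ ⟩
          pow R u q * s          ∎)
          where
          uᵠ≉0 : ¬ pow R u q ≈ 0#
          uᵠ≉0 = pow-≉0 q (λ u≈0 → a≉0 (trans a≈ (u≈0⇒u+ξuᵠ≈0 u≈0)))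
          coordinates : s * u ≈ u′ × s * pow R u q ≈ pow R u′ q
          coordinates = ξ-coordinates-unique
            (InSub-* {Q} s∈ u∈) (InSub-* {Q} s∈ (InSub-pow {Q} q u∈)) u′∈ (InSub-pow {Q} q u′∈)
            (trans (solve 4 (λ s u ξ U → s :* u :+ ξ :* (s :* U) := s :* (u :+ ξ :* U)) refl s u ξ (pow R u q))
                   (trans (*-congˡ (sym a≈)) sa≈))

        Coordinate : Carrier → Carrier → Set (c ⊔ ℓ)
        Coordinate a T = InSxq a × InSub R q T × ∃ λ v → InSub R Q v × a * α ≈ v + ξ * T

        Coordinate-InSub : ∀ {a T} → Coordinate a T → InSub R q T
        Coordinate-InSub (_ , T∈ , _) = T∈

        Coordinate-lincomb : ∀ {k k′ a a′ T T′} → InSub R q k → InSub R q k′ →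
          Coordinate a T → Coordinate a′ T′ → Coordinate (k * a + k′ * a′) (k * T + k′ * T′)
        Coordinate-lincomb {k} {k′} {a} {a′} {T} {T′} k∈ k′∈
          ((u , u∈ , a≈) , T∈ , v , v∈ , aα≈) ((u′ , u′∈ , a′≈) , T′∈ , v′ , v′∈ , a′α≈) =
          (k * u + k′ * u′ , lincomb-InSubQ u∈ u′∈ , (begin
            k * a + k′ * a′
              ≈⟨ +-cong (*-congˡ a≈) (*-congˡ a′≈) ⟩
            k * (u + ξ * pow R u q) + k′ * (u′ + ξ * pow R u′ q)
              ≈⟨ ξ-lincomb k k′ u u′ _ _ ⟩
            (k * u + k′ * u′) + ξ * (k * pow R u q + k′ * pow R u′ q)
              ≈⟨ +-congˡ (*-congˡ (pow-linear additive k∈ k′∈ u u′)) ⟨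
            (k * u + k′ * u′) + ξ * pow R (k * u + k′ * u′) q
              ∎)) ,
          InSub-+ additive (InSub-* {q} k∈ T∈) (InSub-* {q} k′∈ T′∈) ,
          (k * v + k′ * v′ , lincomb-InSubQ v∈ v′∈ , (begin
            (k * a + k′ * a′) * α
              ≈⟨ solve 5 (λ k k′ a a′ α → (k :* a :+ k′ :* a′) :* α := k :* (a :* α) :+ k′ :* (a′ :* α))
                   refl k k′ a a′ α ⟩
            k * (a * α) + k′ * (a′ * α)
              ≈⟨ +-cong (*-congˡ aα≈) (*-congˡ a′α≈) ⟩
            k * (v + ξ * T) + k′ * (v′ + ξ * T′)
              ≈⟨ ξ-lincomb k k′ v v′ T T′ ⟩
            (k * v + k′ * v′) + ξ * (k * T + k′ * T′)
              ∎))
          where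
          ξ-lincomb : ∀ k k′ u u′ A B →
            k * (u + ξ * A) + k′ * (u′ + ξ * B) ≈ (k * u + k′ * u′) + ξ * (k * A + k′ * B)
          ξ-lincomb = solve 7 (λ ξ k k′ u u′ A B →
            k :* (u :+ ξ :* A) :+ k′ :* (u′ :+ ξ :* B) := (k :* u :+ k′ :* u′) :+ ξ :* (k :* A :+ k′ :* B))
            refl ξ
          lincomb-InSubQ : ∀ {x y} → InSub R Q x → InSub R Q y → InSub R Q (k * x + k′ * y)
          lincomb-InSubQ x∈ y∈ =
            InSub-+ additiveQ (InSub-* {Q} (InSub-^ t k∈) x∈) (InSub-* {Q} (InSub-^ t k′∈) y∈)

        open Dependence Coordinate Coordinate-InSub Coordinate-lincomb

        Kernel⇒InSubQ : ∀ {a} → Kernel a → InSub R Q (a * α)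
        Kernel⇒InSubQ {a} (T , (_ , _ , v , v∈ , aα≈) , T≈0) = InSub-resp-≈ {Q} (sym (begin
          a * α     ≈⟨ aα≈ ⟩
          v + ξ * T ≈⟨ +-congˡ (trans (*-congˡ T≈0) (zeroʳ ξ)) ⟩
          v + 0#    ≈⟨ +-identityʳ v ⟩
          v         ∎)) v∈

        kernel-trivial : InSub R Q α → ¬ α ≈ 0# → ∀ {a} → Kernel a → a ≈ 0#
        kernel-trivial α∈ α≉0 (T , ((u , u∈ , a≈) , T∈ , v , v∈ , aα≈) , T≈0) =
          trans a≈ (u≈0⇒u+ξuᵠ≈0 (pow≈0⇒≈0 _≟_ q (*-cancelˡ α≉0 (trans αuᵠ≈T (trans T≈0 (sym (zeroʳ α)))))))
          where
          αuᵠ≈T : α * pow R u q ≈ T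
          αuᵠ≈T = proj₂ (ξ-coordinates-unique
            (InSub-* {Q} α∈ u∈) (InSub-* {Q} α∈ (InSub-pow {Q} q u∈)) v∈ (InSub-^ t T∈)
            (trans (solve 4 (λ α u ξ U → α :* u :+ ξ :* (α :* U) := (u :+ ξ :* U) :* α) refl α u ξ (pow R u q))
                   (trans (*-congʳ (sym a≈)) aα≈)))

        kernel-dependent : ¬ α ≈ 0# → ∀ {a₀ a₁} → Kernel a₀ → Kernel a₁ → Dependent q 2 (a₀ ∷ a₁ ∷ [])
        kernel-dependent α≉0 {a₀} {a₁} k₀@(_ , (a₀∈S , _) , _) k₁@(_ , ((u₁ , u₁∈ , a₁≈) , _) , _)
          with a₀ ≟ 0#
        ... | yes a₀≈0 = dependent-head≈0 {a = a₀ ∷ a₁ ∷ []} a₀≈0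
        ... | no a₀≉0 with proj₂ isField (a₀ * α) (*-≉0 a₀≉0 α≉0)
        ... | w , a₀αw≈1 = (- s ∷ 1# ∷ []) , coefficients , (suc zero , 1≉0) , (begin
          - s * a₀ + (1# * a₁ + 0#)
            ≈⟨ +-cong (sym (-‿distribˡ-* s a₀)) (trans (+-identityʳ _) (*-identityˡ a₁)) ⟩
          - (s * a₀) + a₁            ≈⟨ +-congʳ (-‿cong sa₀≈a₁) ⟩
          - a₁ + a₁                  ≈⟨ -‿inverseˡ a₁ ⟩
          0#                         ∎)
          where
          s : Carrier
          s = a₁ * α * w
          sa₀≈a₁ : s * a₀ ≈ a₁
          sa₀≈a₁ = *-cancelˡ α≉0 (begin
            α * (s * a₀)
              ≈⟨ solve 4 (λ a₀ a₁ α w → α :* (a₁ :* α :* w :* a₀) := a₁ :* α :* (a₀ :* α :* w))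
                   refl a₀ a₁ α w ⟩
            a₁ * α * (a₀ * α * w)  ≈⟨ *-congˡ a₀αw≈1 ⟩
            a₁ * α * 1#            ≈⟨ trans (*-identityʳ _) (*-comm a₁ α) ⟩
            α * a₁                 ∎)
          s∈q : InSub R q s
          s∈q = InSxq-ratio a₀∈S a₀≉0
            (InSub-* {Q} (Kernel⇒InSubQ k₁) (InSub-inverse {Q} (Kernel⇒InSubQ k₀) a₀αw≈1))
            (u₁ , u₁∈ , trans sa₀≈a₁ a₁≈)
          coefficients : ∀ i → InSub R q ((- s ∷ 1# ∷ []) i)
          coefficients zero       = InSub-neg additive s∈q
          coefficients (suc zero) = InSub-1# {q}

        coordinate : ∀ {a b} → InU R q t ξ (a , b) → InSpan R (1# , α) (a , b) → ∃ (Coordinate a)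
        coordinate (a∈ , v , v∈ , b≈) span =
          Tr R q t v , a∈ , Tr-InSub additive t v∈ , v , v∈ , trans (sym (InSpan-graph span)) b≈

        weight≤ : ∀ k →
          (∀ (a : Fin (suc k) → Carrier) → (∀ i → ∃ (Coordinate (a i))) → Dependent q (suc k) a) →
          WeightAtMost R q (InU R q t ξ) (1# , α) k
        weight≤ k dependent =
          dimAtMost-of-graph {q} {P = λ w → InU R q t ξ w × InSpan R (1# , α) w} α k
            (λ P-ab → InSpan-graph (proj₂ P-ab))
            (λ f₁ _ P-f → dependent f₁ (λ i → coordinate (proj₁ (P-f i)) (proj₂ (P-f i))))

        weight≤1 : InSub R Q α → ¬ α ≈ 0# → WeightAtMost R q (InU R q t ξ) (1# , α) 1
        weight≤1 α∈ α≉0 = weight≤ 1 λ _ c →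
          dependent₂ (kernel-trivial α∈ α≉0) (proj₂ (c zero)) (proj₂ (c (suc zero)))

        weight≤2 : ¬ α ≈ 0# → WeightAtMost R q (InU R q t ξ) (1# , α) 2
        weight≤2 α≉0 = weight≤ 2 λ _ c →
          dependent₃ (kernel-dependent α≉0) (proj₂ (c zero)) (proj₂ (c (suc zero)))
                                            (proj₂ (c (suc (suc zero))))

open import Data.Nat using (_^_; _*_; _≥_)

proposition4p4 : {c ℓ : Level} (p e t : ℕ) → Prime p → e ≥ 1 → t ≥ 1 →
    (R : CommutativeRing c ℓ) → IsField R → HasCard R ((p ^ e) ^ (2 * t)) →
    (ξ : CommutativeRing.Carrier R) →
    ¬ InSub R ((p ^ e) ^ t) ξ →
    (α : CommutativeRing.Carrier R) →
      ((InSub R ((p ^ e) ^ t) α → ¬ CommutativeRing._≈_ R α (CommutativeRing.0# R) →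
          WeightAtMost R (p ^ e) (InU R (p ^ e) t ξ) (CommutativeRing.1# R , α) 1)
      × (¬ CommutativeRing._≈_ R α (CommutativeRing.0# R) →
          WeightAtMost R (p ^ e) (InU R (p ^ e) t ξ) (CommutativeRing.1# R , α) 2))
proposition4p4 p e t p-prime _ _ R isField card ξ ξ∉ α = weight≤1 , weight≤2
  where
  card′ : HasCard R (p ^ (e * (2 * t)))
  card′ = ≡.subst (HasCard R) (ℕₚ.^-*-assoc p e (2 * t)) card
  additive : PowAdditive R (p ^ e)
  additive = powAdditive-^ R (finite-frobenius R isField {p} {e * (2 * t)} p-prime card′) e
  open Weight R isField (≈-decidable R card) additive t ξ ξ∉ α
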